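{- Let $\mathcal{U}$ be a finite family (possibly a multiset) of finite sets and $\tilde\varrho$ a permutation of $\mathcal{U}$. If there exists $\emptyset\neq\mathcal{U}_1\subseteq\mathcal{U}$ with $\ell_{\mathcal{U},\mathcal{U}_1}\neq\ell_{\mathcal{U},\tilde\varrho(\mathcal{U}_1)}$, then there exist $\mathcal{U}_2,\mathcal{U}_3\subseteq\mathcal{U}$ such that $|\mathcal{U}_2|\le 2$ or $\mathcal{U}_2$ is an antichain with respect to inclusion, $\emptyset\neq\mathcal{U}_3\subseteq\mathcal{U}_2$, and $\ell_{\mathcal{U}_2,\mathcal{U}_3}\neq\ell_{\tilde\varrho(\mathcal{U}_2),\tilde\varrho(\mathcal{U}_3)}$.
   Context: For a subfamily $\mathcal{W}\subseteq\mathcal{U}$, $\tilde\varrho(\mathcal{W})=\{\tilde\varrho(A):A\in\mathcal{W}\}$. For a family $\mathcal{U}'$ and nonempty $\mathcal{U}_0\subseteq\mathcal{U}'$, $\ell_{\mathcal{U}',\mathcal{U}_0}=\big|\bigcap_{A\in\mathcal{U}_0}A\setminus\bigcup_{B\in\mathcal{U}'\setminus\mathcal{U}_0}B\big|$. -}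

module Defs where

open import Data.Nat using (ℕ)
open import Data.Bool using (Bool; true; false; _∧_; _∨_; not)
open import Data.Fin using (Fin)
open import Data.Fin.Subset using (Subset; _─_; ∣_∣)
open import Data.Fin.Permutation using (Permutation′; _⟨$⟩ˡ_)
open import Data.Vec using (lookup; tabulate; foldr′; zipWith)

-- A finite family (multiset) of finite sets: n members, indexed by Fin n,
-- each a subset of a common finite ground set Fin m.
Family : ℕ → ℕ → Set
Family n m = Fin n → Subset m

inAll : ∀ {n m} → Family n m → Subset n → Fin m → Bool
inAll {n} U W x = foldr′ _∧_ true (tabulate λ i → not (lookup W i) ∨ lookup (U i) x)

inNone : ∀ {n m} → Family n m → Subset n → Fin m → Bool
inNone {n} U W x = foldr′ _∧_ true (tabulate λ i → not (lookup W i ∧ lookup (U i) x))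

-- ℓ_{U',U₀} = | ⋂_{A∈U₀} A  \  ⋃_{B∈U'∖U₀} B |, with U', U₀ given as
-- subfamilies (index sets) of U.
ell : ∀ {n m} → Family n m → Subset n → Subset n → ℕ
ell U U' U₀ = ∣ tabulate (λ x → inAll U U₀ x ∧ inNone U (U' ─ U₀) x) ∣

-- Image of a subfamily W under the permutation ρ̃ of the members of U:
-- ρ̃(W) = { ρ̃(A) : A ∈ W }, i.e. j ∈ ρ̃(W) iff ρ⁻¹(j) ∈ W.
image : ∀ {n} → Permutation′ n → Subset n → Subset n
image ρ W = tabulate λ j → lookup W (ρ ⟨$⟩ˡ j)

module Submission where

-- Write V = U ∘ ρ for the family U with its members renumbered by ρ.  Since
-- ρ only moves indices, ℓ_{ρ̃(P),ρ̃(Q)} for U equals ℓ_{P,Q} for V, so the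
-- theorem compares the region sizes ℓ of two families U, V on the same
-- index sets.
--
--  1. Inclusion–exclusion.  For B ∈ P ∖ Q, the deletion–contraction
--     identity  ℓ_{P−B,Q} = ℓ_{P,Q∪{B}} + ℓ_{P,Q}  shows that a difference
--     ℓ_{P,Q}(U) ≠ ℓ_{P,Q}(V) propagates to a pair with smaller P ∖ Q; at
--     P ∖ Q = ∅ it is a difference of intersection sizes ℓ_{Q,Q}.
--  2. Antichain reduction.  If Q contains i ≠ j with U i ⊆ U j, then either
--     the pair ({i,j},{i}) separates U from V (ℓ = |U i ∖ U j| = 0 for U),
--     or V i ⊆ V j as well, and dropping j from Q changes neither
--     intersection.  Induction on |Q| ends at an antichain.

open import Defs
open import Data.Nat using (_≤_)
open import Data.Fin using (Fin)
open import Data.Fin.Subset using (Subset; ⊤; _∈_; _⊆_; ∣_∣; Nonempty)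
open import Data.Fin.Permutation using (Permutation′; _⟨$⟩ʳ_)
open import Data.Product using (_×_; ∃; ∃₂)
open import Data.Sum using (_⊎_)
open import Relation.Nullary using (¬_)
open import Relation.Binary.PropositionalEquality using (_≡_; _≢_)

open import Data.Nat using (zero; suc; _+_; _<_; z≤n; s≤s)
open import Data.Nat.Properties
  using (+-suc; +-monoʳ-≤; n≤1+n; ≤-trans; ≤-refl; ≤-pred; <-≤-trans; +-cancelˡ-≡)
  renaming (_≟_ to _≟ℕ_)
open import Data.Bool using (Bool; true; false; T; _∧_; _∨_; not)
open import Data.Bool.Properties using (T-∧; T-≡)
open import Data.Unit using (tt)
open import Data.Empty using (⊥-elim)
open import Data.Fin using (zero; suc)
open import Data.Fin.Properties using (any?) renaming (_≟_ to _≟ᶠ_)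
open import Data.Fin.Subset using (_∉_; _─_; _∪_; _-_; ⁅_⁆; Empty; inside; outside)
open import Data.Fin.Subset.Properties
  using (_∈?_; _⊆?_; nonempty?; ∈⊤; ⊆⊤; ⊆-refl; ⊆-antisym; p─q⊆p; x∈p∧x∉q⇒x∈p─q;
         x∈p∧x≢y⇒x∈p-y; p─q─r≡p─q∪r; p─q─r≡p─r─q; x∈p⇒∣p-x∣<∣p∣;
         x∈⁅x⁆; x∈⁅y⁆⇒x≡y; x≢y⇒x∉⁅y⁆; ∣⁅x⁆∣≡1; p⊆p∪q; x∈p∪q⁺; x∈p∪q⁻)
open import Data.Fin.Permutation using (_⟨$⟩ˡ_; inverseˡ; inverseʳ)
open import Data.Vec using (_∷_; []; there; lookup; tabulate; foldr′)
open import Data.Vec.Properties using (lookup∘tabulate; tabulate-cong; []=⇒lookup; lookup⇒[]=)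
open import Data.Product using (_,_; proj₁; proj₂)
open import Data.Sum using (inj₁; inj₂; [_,_])
open import Function using (_∘_; case_of_)
open import Function.Bundles using (_⇔_; mk⇔; module Equivalence)
open Equivalence using (to; from)
open import Relation.Nullary using (Dec; yes; no; ¬?; contradiction)
open import Relation.Nullary.Decidable using (_×-dec_)
open import Relation.Binary.PropositionalEquality using (refl; sym; trans; cong; cong₂; subst; subst₂; module ≡-Reasoning)

T-all : ∀ {n} (g : Fin n → Bool) → T (foldr′ _∧_ true (tabulate g)) ⇔ (∀ i → T (g i))
T-all {zero} g = mk⇔ (λ _ ()) (λ _ → tt)
T-all {suc n} g = mk⇔
  (λ t → λ { zero → proj₁ (to T-∧ t) ; (suc i) → to (T-all (g ∘ suc)) (proj₂ (to T-∧ t)) i })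
  (λ h → from T-∧ (h zero , from (T-all (g ∘ suc)) (h ∘ suc)))

T-not : ∀ b → T (not b) ⇔ (¬ T b)
T-not true = mk⇔ (λ ()) (λ f → f tt)
T-not false = mk⇔ (λ _ ()) (λ _ → tt)

T-implies : ∀ a b → T (not a ∨ b) ⇔ (T a → T b)
T-implies true b = mk⇔ (λ t _ → t) (λ f → f tt)
T-implies false b = mk⇔ (λ _ ()) (λ _ → tt)

T-nand : ∀ a b → T (not (a ∧ b)) ⇔ (¬ (T a × T b))
T-nand true true = mk⇔ (λ ()) (λ f → f (tt , tt))
T-nand true false = mk⇔ (λ _ → proj₂) (λ _ → tt)
T-nand false b = mk⇔ (λ _ → proj₁) (λ _ → tt)

T-ext : ∀ {a b} → (T a → T b) → (T b → T a) → a ≡ b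
T-ext {true} {true} _ _ = refl
T-ext {true} {false} a⇒b _ = ⊥-elim (a⇒b tt)
T-ext {false} {true} _ b⇒a = ⊥-elim (b⇒a tt)
T-ext {false} {false} _ _ = refl

count-cong : ∀ {m} {f g : Fin m → Bool} → (∀ x → T (f x) → T (g x)) → (∀ x → T (g x) → T (f x))
  → ∣ tabulate f ∣ ≡ ∣ tabulate g ∣
count-cong f⇒g g⇒f = cong ∣_∣ (tabulate-cong λ x → T-ext (f⇒g x) (g⇒f x))

count-split : ∀ {m} (f h : Fin m → Bool)
  → ∣ tabulate f ∣ ≡ ∣ tabulate (λ x → f x ∧ h x) ∣ + ∣ tabulate (λ x → f x ∧ not (h x)) ∣
count-split {zero} f h = refl
count-split {suc m} f h with f zero | h zero
... | true | true = cong suc (count-split (f ∘ suc) (h ∘ suc))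
... | true | false = trans (cong suc (count-split (f ∘ suc) (h ∘ suc))) (sym (+-suc _ _))
... | false | _ = count-split (f ∘ suc) (h ∘ suc)

count-zero : ∀ {m} (f : Fin m → Bool) → ∣ tabulate f ∣ ≡ 0 ⇔ (∀ x → ¬ T (f x))
count-zero f = mk⇔ (none f) (zero-count f)
  where
  none : ∀ {m} (f : Fin m → Bool) → ∣ tabulate f ∣ ≡ 0 → ∀ x → ¬ T (f x)
  none {suc m} f e x with f zero in f₀
  none {suc m} f () x | true
  none {suc m} f e zero | false = subst T f₀
  none {suc m} f e (suc x) | false = none (f ∘ suc) e x

  zero-count : ∀ {m} (f : Fin m → Bool) → (∀ x → ¬ T (f x)) → ∣ tabulate f ∣ ≡ 0
  zero-count {zero} f _ = refl
  zero-count {suc m} f nowhere with f zero in f₀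
  ... | true = ⊥-elim (nowhere zero (subst T (sym f₀) tt))
  ... | false = zero-count (f ∘ suc) (nowhere ∘ suc)

∈⇔T : ∀ {n} {i : Fin n} {p : Subset n} → i ∈ p ⇔ T (lookup p i)
∈⇔T {i = i} {p} = mk⇔ (λ i∈p → from T-≡ ([]=⇒lookup i∈p)) (λ t → lookup⇒[]= i p (to T-≡ t))

x∈p─q⇒x∉q : ∀ {n} (p q : Subset n) {i} → i ∈ p ─ q → i ∉ q
x∈p─q⇒x∉q (s ∷ p) (t ∷ q) (there i∈p─q) (there i∈q) = x∈p─q⇒x∉q p q i∈p─q i∈q

∣p∪q∣≤∣p∣+∣q∣ : ∀ {n} (p q : Subset n) → ∣ p ∪ q ∣ ≤ ∣ p ∣ + ∣ q ∣
∣p∪q∣≤∣p∣+∣q∣ [] [] = z≤n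
∣p∪q∣≤∣p∣+∣q∣ (outside ∷ p) (outside ∷ q) = ∣p∪q∣≤∣p∣+∣q∣ p q
∣p∪q∣≤∣p∣+∣q∣ (outside ∷ p) (inside ∷ q) =
  subst (suc ∣ p ∪ q ∣ ≤_) (sym (+-suc ∣ p ∣ ∣ q ∣)) (s≤s (∣p∪q∣≤∣p∣+∣q∣ p q))
∣p∪q∣≤∣p∣+∣q∣ (inside ∷ p) (outside ∷ q) = s≤s (∣p∪q∣≤∣p∣+∣q∣ p q)
∣p∪q∣≤∣p∣+∣q∣ (inside ∷ p) (inside ∷ q) =
  s≤s (≤-trans (∣p∪q∣≤∣p∣+∣q∣ p q) (+-monoʳ-≤ ∣ p ∣ (n≤1+n ∣ q ∣)))

∈-image : ∀ {n} (ρ : Permutation′ n) (P : Subset n) {j} → j ∈ image ρ P ⇔ ρ ⟨$⟩ˡ j ∈ P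
∈-image ρ P {j} = mk⇔
  (λ j∈ρP → from ∈⇔T (subst T (lookup∘tabulate look j) (to ∈⇔T j∈ρP)))
  (λ ρj∈P → from ∈⇔T (subst T (sym (lookup∘tabulate look j)) (to ∈⇔T ρj∈P)))
  where
  look : Fin _ → Bool
  look k = lookup P (ρ ⟨$⟩ˡ k)

image-⊤ : ∀ {n} (ρ : Permutation′ n) → image ρ ⊤ ≡ ⊤
image-⊤ ρ = ⊆-antisym ⊆⊤ (λ _ → from (∈-image ρ ⊤) ∈⊤)

InRegion : ∀ {n m} → Family n m → Subset n → Subset n → Fin m → Set
InRegion W P Q x = (∀ i → i ∈ Q → x ∈ W i) × (∀ i → i ∈ P → i ∉ Q → x ∉ W i)

region : ∀ {n m} → Family n m → Subset n → Subset n → Fin m → Bool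
region W P Q x = inAll W Q x ∧ inNone W (P ─ Q) x

region-⇔ : ∀ {n m} (W : Family n m) P Q x → T (region W P Q x) ⇔ InRegion W P Q x
region-⇔ W P Q x = mk⇔
  (λ t → let (t-all , t-none) = to T-∧ t in in-all t-all , in-none t-none)
  (λ (all , none) → from T-∧ (all-in all , none-in none))
  where
  clauseAll = λ i → not (lookup Q i) ∨ lookup (W i) x
  clauseNone = λ i → not (lookup (P ─ Q) i ∧ lookup (W i) x)

  in-all : T (inAll W Q x) → ∀ i → i ∈ Q → x ∈ W i
  in-all t i i∈Q = from ∈⇔T (to (T-implies _ _) (to (T-all clauseAll) t i) (to ∈⇔T i∈Q))

  all-in : (∀ i → i ∈ Q → x ∈ W i) → T (inAll W Q x)
  all-in all = from (T-all clauseAll) λ i →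
    from (T-implies _ _) (λ t → to ∈⇔T (all i (from ∈⇔T t)))

  in-none : T (inNone W (P ─ Q) x) → ∀ i → i ∈ P → i ∉ Q → x ∉ W i
  in-none t i i∈P i∉Q x∈Wi = to (T-nand _ _) (to (T-all clauseNone) t i)
    (to ∈⇔T (x∈p∧x∉q⇒x∈p─q i∈P i∉Q) , to ∈⇔T x∈Wi)

  none-in : (∀ i → i ∈ P → i ∉ Q → x ∉ W i) → T (inNone W (P ─ Q) x)
  none-in none = from (T-all clauseNone) λ i → from (T-nand _ _) λ (t , u) →
    none i (p─q⊆p P Q (from ∈⇔T t)) (x∈p─q⇒x∉q P Q (from ∈⇔T t)) (from ∈⇔T u)

ell-cong : ∀ {n m} {W W′ : Family n m} {P P′ Q Q′ : Subset n}
  → (∀ x → InRegion W P Q x → InRegion W′ P′ Q′ x)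
  → (∀ x → InRegion W′ P′ Q′ x → InRegion W P Q x)
  → ell W P Q ≡ ell W′ P′ Q′
ell-cong {W = W} {W′} {P} {P′} {Q} {Q′} fwd bwd = count-cong
  (λ x → from (region-⇔ W′ P′ Q′ x) ∘ fwd x ∘ to (region-⇔ W P Q x))
  (λ x → from (region-⇔ W P Q x) ∘ bwd x ∘ to (region-⇔ W′ P′ Q′ x))

ell-zero : ∀ {n m} (W : Family n m) P Q → ell W P Q ≡ 0 ⇔ (∀ x → ¬ InRegion W P Q x)
ell-zero W P Q = mk⇔
  (λ e x → to (count-zero (region W P Q)) e x ∘ from (region-⇔ W P Q x))
  (λ none → from (count-zero (region W P Q)) λ x → none x ∘ to (region-⇔ W P Q x))

relabel : ∀ {n m} → Permutation′ n → Family n m → Family n m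
relabel ρ U i = U (ρ ⟨$⟩ʳ i)

-- Renumbering the family renumbers its regions: ρ̃ moves indices, not sets.
ell-image : ∀ {n m} (U : Family n m) (ρ : Permutation′ n) P Q
  → ell U (image ρ P) (image ρ Q) ≡ ell (relabel ρ U) P Q
ell-image U ρ P Q = ell-cong
  (λ x (all , none) →
      (λ i i∈Q → all (ρ ⟨$⟩ʳ i) (back Q i∈Q))
    , (λ i i∈P i∉Q → none (ρ ⟨$⟩ʳ i) (back P i∈P) (i∉Q ∘ forth Q)))
  (λ x (all , none) →
      (λ j j∈ρQ → subst (λ k → x ∈ U k) (inverseʳ ρ) (all (ρ ⟨$⟩ˡ j) (to (∈-image ρ Q) j∈ρQ)))
    , (λ j j∈ρP j∉ρQ → subst (λ k → x ∉ U k) (inverseʳ ρ)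
          (none (ρ ⟨$⟩ˡ j) (to (∈-image ρ P) j∈ρP) (j∉ρQ ∘ from (∈-image ρ Q)))))
  where
  back : ∀ R {i} → i ∈ R → ρ ⟨$⟩ʳ i ∈ image ρ R
  back R i∈R = from (∈-image ρ R) (subst (_∈ R) (sym (inverseˡ ρ)) i∈R)

  forth : ∀ R {i} → ρ ⟨$⟩ʳ i ∈ image ρ R → i ∈ R
  forth R ρi∈ρR = subst (_∈ R) (inverseˡ ρ) (to (∈-image ρ R) ρi∈ρR)

ell-refine : ∀ {n m} (W : Family n m) P Q B {P₁ Q₁ P₀ Q₀}
  → (∀ x → (InRegion W P Q x × x ∈ W B) ⇔ InRegion W P₁ Q₁ x)
  → (∀ x → (InRegion W P Q x × x ∉ W B) ⇔ InRegion W P₀ Q₀ x)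
  → ell W P Q ≡ ell W P₁ Q₁ + ell W P₀ Q₀
ell-refine W P Q B {P₁} {Q₁} {P₀} {Q₀} in-B out-B =
  trans (count-split (region W P Q) (λ x → lookup (W B) x))
        (cong₂ _+_ (count-cong (λ x → from (region-⇔ W P₁ Q₁ x) ∘ to (in-B x) ∘ split-in x)
                               (λ x → split-out x ∘ from (in-B x) ∘ to (region-⇔ W P₁ Q₁ x)))
                   (count-cong (λ x → from (region-⇔ W P₀ Q₀ x) ∘ to (out-B x) ∘ split-in′ x)
                               (λ x → split-out′ x ∘ from (out-B x) ∘ to (region-⇔ W P₀ Q₀ x))))
  where
  split-in : ∀ x → T (region W P Q x ∧ lookup (W B) x) → InRegion W P Q x × x ∈ W B
  split-in x t = let (r , b) = to T-∧ t in to (region-⇔ W P Q x) r , from ∈⇔T b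

  split-out : ∀ x → InRegion W P Q x × x ∈ W B → T (region W P Q x ∧ lookup (W B) x)
  split-out x (r , b) = from T-∧ (from (region-⇔ W P Q x) r , to ∈⇔T b)

  split-in′ : ∀ x → T (region W P Q x ∧ not (lookup (W B) x)) → InRegion W P Q x × x ∉ W B
  split-in′ x t = let (r , b) = to T-∧ t in to (region-⇔ W P Q x) r , to (T-not _) b ∘ to ∈⇔T

  split-out′ : ∀ x → InRegion W P Q x × x ∉ W B → T (region W P Q x ∧ not (lookup (W B) x))
  split-out′ x (r , b) = from T-∧ (from (region-⇔ W P Q x) r , from (T-not _) (b ∘ from ∈⇔T))

∈-remove : ∀ {n} (P : Subset n) {B i} → i ∈ P - B → i ∈ P × i ≢ B
∈-remove P {B} i∈P-B = p─q⊆p P ⁅ B ⁆ i∈P-B , λ { refl → x∈p─q⇒x∉q P ⁅ B ⁆ i∈P-B (x∈⁅x⁆ B) }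

region-contract : ∀ {n m} (W : Family n m) P Q B x
  → (InRegion W (P - B) Q x × x ∈ W B) ⇔ InRegion W P (Q ∪ ⁅ B ⁆) x
region-contract W P Q B x = mk⇔
  (λ ((all , none) , x∈WB) →
      (λ i i∈Q∪B → [ all i , (λ i∈B → subst (λ k → x ∈ W k) (sym (x∈⁅y⁆⇒x≡y B i∈B)) x∈WB) ]
                     (x∈p∪q⁻ Q ⁅ B ⁆ i∈Q∪B))
    , (λ i i∈P i∉Q∪B → none i (x∈p∧x∉q⇒x∈p─q i∈P (i∉Q∪B ∘ x∈p∪q⁺ ∘ inj₂))
                              (i∉Q∪B ∘ x∈p∪q⁺ ∘ inj₁)))
  (λ (all , none) →
      ( (λ i i∈Q → all i (x∈p∪q⁺ (inj₁ i∈Q)))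
      , (λ i i∈P-B i∉Q → let (i∈P , i≢B) = ∈-remove P i∈P-B in
           none i i∈P λ i∈Q∪B → [ i∉Q , i≢B ∘ x∈⁅y⁆⇒x≡y B ] (x∈p∪q⁻ Q ⁅ B ⁆ i∈Q∪B)))
    , all B (x∈p∪q⁺ (inj₂ (x∈⁅x⁆ B))))

region-delete : ∀ {n m} (W : Family n m) P Q {B} → B ∈ P → B ∉ Q → ∀ x
  → (InRegion W (P - B) Q x × x ∉ W B) ⇔ InRegion W P Q x
region-delete W P Q {B} B∈P B∉Q x = mk⇔
  (λ ((all , none) , x∉WB) → all , λ i i∈P i∉Q → case i ≟ᶠ B of λ
    { (yes refl) → x∉WB
    ; (no i≢B) → none i (x∈p∧x≢y⇒x∈p-y i∈P i≢B) i∉Q })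
  (λ (all , none) → (all , λ i i∈P-B → none i (proj₁ (∈-remove P i∈P-B))) , none B B∈P B∉Q)

ell-split : ∀ {n m} (W : Family n m) P Q {B} → B ∈ P → B ∉ Q
  → ell W (P - B) Q ≡ ell W P (Q ∪ ⁅ B ⁆) + ell W P Q
ell-split W P Q {B} B∈P B∉Q =
  ell-refine W (P - B) Q B (region-contract W P Q B) (region-delete W P Q B∈P B∉Q)

ell-no-excluded : ∀ {n m} (W : Family n m) P Q → Empty (P ─ Q) → ell W P Q ≡ ell W Q Q
ell-no-excluded W P Q nothing = ell-cong {W = W} {W′ = W}
  (λ x (all , _) → all , λ i i∈Q i∉Q → contradiction i∈Q i∉Q)
  (λ x (all , _) → all , λ i i∈P i∉Q → ⊥-elim (nothing (i , x∈p∧x∉q⇒x∈p─q i∈P i∉Q)))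

-- Intersections over Q: the exclusion condition of InRegion W Q Q is vacuous.
ell-diag-cong : ∀ {n m} (W : Family n m) Q Q′
  → (∀ x → (∀ i → i ∈ Q → x ∈ W i) → (∀ i → i ∈ Q′ → x ∈ W i))
  → (∀ x → (∀ i → i ∈ Q′ → x ∈ W i) → (∀ i → i ∈ Q → x ∈ W i))
  → ell W Q Q ≡ ell W Q′ Q′
ell-diag-cong W Q Q′ fwd bwd = ell-cong {W = W} {W′ = W}
  (λ x (all , _) → fwd x all , λ i i∈Q′ i∉Q′ → contradiction i∈Q′ i∉Q′)
  (λ x (all , _) → bwd x all , λ i i∈Q i∉Q → contradiction i∈Q i∉Q)

-- Induction on |P ∖ Q|: for B ∈ P ∖ Q,
-- deletion–contraction passes the difference to (P, Q ∪ {B}) or (P − B, Q).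
differing-intersection : ∀ {n m} (U V : Family n m) P Q → Nonempty Q → ell U P Q ≢ ell V P Q
  → ∃ λ Q′ → Nonempty Q′ × ell U Q′ Q′ ≢ ell V Q′ Q′
differing-intersection U V P Q = go (suc ∣ P ─ Q ∣) P Q ≤-refl
  where
  go : ∀ k P Q → ∣ P ─ Q ∣ < k → Nonempty Q → ell U P Q ≢ ell V P Q
    → ∃ λ Q′ → Nonempty Q′ × ell U Q′ Q′ ≢ ell V Q′ Q′
  go (suc k) P Q size (i , i∈Q) differs with nonempty? (P ─ Q)
  ... | no nothing = Q , (i , i∈Q) , λ e →
        differs (trans (ell-no-excluded U P Q nothing) (trans e (sym (ell-no-excluded V P Q nothing))))
  ... | yes (B , B∈P─Q) with ell U P (Q ∪ ⁅ B ⁆) ≟ℕ ell V P (Q ∪ ⁅ B ⁆)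
  ...   | no contraction-differs =
          go k P (Q ∪ ⁅ B ⁆) (<-≤-trans shrink-contract (≤-pred size))
             (i , x∈p∪q⁺ (inj₁ i∈Q)) contraction-differs
    where
    shrink-contract : ∣ P ─ (Q ∪ ⁅ B ⁆) ∣ < ∣ P ─ Q ∣
    shrink-contract = subst (λ R → ∣ R ∣ < ∣ P ─ Q ∣) (p─q─r≡p─q∪r P Q ⁅ B ⁆) (x∈p⇒∣p-x∣<∣p∣ B∈P─Q)
  ...   | yes contraction-same =
          go k (P - B) Q (<-≤-trans shrink-delete (≤-pred size)) (i , i∈Q) deletion-differs
    where
    B∈P = p─q⊆p P Q B∈P─Q
    B∉Q = x∈p─q⇒x∉q P Q B∈P─Q

    shrink-delete : ∣ P - B ─ Q ∣ < ∣ P ─ Q ∣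
    shrink-delete = subst (λ R → ∣ R ∣ < ∣ P ─ Q ∣) (p─q─r≡p─r─q P Q ⁅ B ⁆) (x∈p⇒∣p-x∣<∣p∣ B∈P─Q)

    deletion-differs : ell U (P - B) Q ≢ ell V (P - B) Q
    deletion-differs e = differs (+-cancelˡ-≡ (ell U P (Q ∪ ⁅ B ⁆)) _ _ (begin
      ell U P (Q ∪ ⁅ B ⁆) + ell U P Q  ≡⟨ sym (ell-split U P Q B∈P B∉Q) ⟩
      ell U (P - B) Q                  ≡⟨ e ⟩
      ell V (P - B) Q                  ≡⟨ ell-split V P Q B∈P B∉Q ⟩
      ell V P (Q ∪ ⁅ B ⁆) + ell V P Q  ≡⟨ cong (_+ ell V P Q) (sym contraction-same) ⟩
      ell U P (Q ∪ ⁅ B ⁆) + ell V P Q  ∎))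
      where open ≡-Reasoning

Antichain : ∀ {n m} → Family n m → Subset n → Set
Antichain U W = ∀ i j → i ∈ W → j ∈ W → i ≢ j → ¬ (U i ⊆ U j)

ComparablePair : ∀ {n m} → Family n m → Subset n → Set
ComparablePair U W = ∃₂ λ i j → i ∈ W × j ∈ W × i ≢ j × U i ⊆ U j

comparable? : ∀ {n m} (U : Family n m) W → Dec (ComparablePair U W)
comparable? U W = any? λ i → any? λ j →
  (i ∈? W) ×-dec (j ∈? W) ×-dec ¬? (i ≟ᶠ j) ×-dec (U i ⊆? U j)

Separation : ∀ {n m} → Family n m → Family n m → Set
Separation {n} U V = ∃₂ λ (U₂ U₃ : Subset n) →
  (∣ U₂ ∣ ≤ 2 ⊎ Antichain U U₂) × Nonempty U₃ × U₃ ⊆ U₂ × ell U U₂ U₃ ≢ ell V U₂ U₃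

pair : ∀ {n} → Fin n → Fin n → Subset n
pair i j = ⁅ i ⁆ ∪ ⁅ j ⁆

∣pair∣≤2 : ∀ {n} (i j : Fin n) → ∣ pair i j ∣ ≤ 2
∣pair∣≤2 i j = subst₂ (λ a b → ∣ pair i j ∣ ≤ a + b) (∣⁅x⁆∣≡1 i) (∣⁅x⁆∣≡1 j) (∣p∪q∣≤∣p∣+∣q∣ ⁅ i ⁆ ⁅ j ⁆)

-- ℓ_{{i,j},{i}} counts W i ∖ W j, so it vanishes exactly when W i ⊆ W j.
ell-pair-zero : ∀ {n m} (W : Family n m) {i j} → i ≢ j → ell W (pair i j) ⁅ i ⁆ ≡ 0 ⇔ W i ⊆ W j
ell-pair-zero W {i} {j} i≢j = mk⇔
  (λ e {x} x∈Wi → case x ∈? W j of λ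
    { (yes x∈Wj) → x∈Wj
    ; (no x∉Wj) → ⊥-elim (to (ell-zero W (pair i j) ⁅ i ⁆) e x (in-difference x∈Wi x∉Wj)) })
  (λ Wi⊆Wj → from (ell-zero W (pair i j) ⁅ i ⁆) λ x (all , none) →
    none j (x∈p∪q⁺ (inj₂ (x∈⁅x⁆ j))) (x≢y⇒x∉⁅y⁆ (i≢j ∘ sym)) (Wi⊆Wj (all i (x∈⁅x⁆ i))))
  where
  in-difference : ∀ {x} → x ∈ W i → x ∉ W j → InRegion W (pair i j) ⁅ i ⁆ x
  in-difference {x} x∈Wi x∉Wj =
      (λ k k∈i → subst (λ l → x ∈ W l) (sym (x∈⁅y⁆⇒x≡y i k∈i)) x∈Wi)
    , (λ k k∈ij k∉i → [ (λ k∈i → contradiction k∈i k∉i)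
                      , (λ k∈j → subst (λ l → x ∉ W l) (sym (x∈⁅y⁆⇒x≡y j k∈j)) x∉Wj) ]
                      (x∈p∪q⁻ ⁅ i ⁆ ⁅ j ⁆ k∈ij))

ell-drop-superset : ∀ {n m} (W : Family n m) {Q i j} → i ∈ Q → i ≢ j → W i ⊆ W j
  → ell W (Q - j) (Q - j) ≡ ell W Q Q
ell-drop-superset W {Q} {i} {j} i∈Q i≢j Wi⊆Wj = ell-diag-cong W (Q - j) Q
  (λ x all k k∈Q → case k ≟ᶠ j of λ
    { (yes refl) → Wi⊆Wj (all i (x∈p∧x≢y⇒x∈p-y i∈Q i≢j))
    ; (no k≢j) → all k (x∈p∧x≢y⇒x∈p-y k∈Q k≢j) })
  (λ x all k k∈Q-j → all k (p─q⊆p Q ⁅ j ⁆ k∈Q-j))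

-- Induction on |Q|: a comparable pair U i ⊆ U j either
-- separates, or forces V i ⊆ V j, and then j can be dropped.
separate : ∀ {n m} (U V : Family n m) Q → Nonempty Q → ell U Q Q ≢ ell V Q Q → Separation U V
separate U V Q = go (suc ∣ Q ∣) Q ≤-refl
  where
  go : ∀ k Q → ∣ Q ∣ < k → Nonempty Q → ell U Q Q ≢ ell V Q Q → Separation U V
  go (suc k) Q size nonempty differs with comparable? U Q
  ... | no incomparable = Q , Q , inj₂ antichain , nonempty , ⊆-refl , differs
    where
    antichain : Antichain U Q
    antichain i j i∈Q j∈Q i≢j Ui⊆Uj = incomparable (i , j , i∈Q , j∈Q , i≢j , Ui⊆Uj)
  ... | yes (i , j , i∈Q , j∈Q , i≢j , Ui⊆Uj)
          with ell U (pair i j) ⁅ i ⁆ ≟ℕ ell V (pair i j) ⁅ i ⁆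
  ...   | no pair-differs =
          pair i j , ⁅ i ⁆ , inj₁ (∣pair∣≤2 i j) , (i , x∈⁅x⁆ i) , p⊆p∪q ⁅ j ⁆ , pair-differs
  ...   | yes pair-same =
          go k (Q - j) (<-≤-trans (x∈p⇒∣p-x∣<∣p∣ j∈Q) (≤-pred size))
             (i , x∈p∧x≢y⇒x∈p-y i∈Q i≢j) dropped-differs
    where
    Vi⊆Vj : V i ⊆ V j
    Vi⊆Vj = to (ell-pair-zero V i≢j) (trans (sym pair-same) (from (ell-pair-zero U i≢j) Ui⊆Uj))

    dropped-differs : ell U (Q - j) (Q - j) ≢ ell V (Q - j) (Q - j)
    dropped-differs e = differs (trans (sym (ell-drop-superset U i∈Q i≢j Ui⊆Uj))
                                       (trans e (ell-drop-superset V i∈Q i≢j Vi⊆Vj)))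

-- Renumbering turns the hypothesis into a difference of region sizes between
-- U and V = U ∘ ρ; reduction 1 makes it a difference of intersections,
-- reduction 2 separates U from V, and renumbering back gives the conclusion.
lemma4 : ∀ {n m} (U : Family n m) (ρ : Permutation′ n)
    → (∃ λ (U₁ : Subset n) → Nonempty U₁ × ell U ⊤ U₁ ≢ ell U ⊤ (image ρ U₁))
    → ∃₂ λ (U₂ U₃ : Subset n) →
        (∣ U₂ ∣ ≤ 2 ⊎ (∀ i j → i ∈ U₂ → j ∈ U₂ → i ≢ j → ¬ (U i ⊆ U j)))
        × Nonempty U₃ × U₃ ⊆ U₂
        × ell U U₂ U₃ ≢ ell U (image ρ U₂) (image ρ U₃)
lemma4 U ρ (U₁ , nonempty , differs) =
  let (Q , nonempty-Q , differs-Q) = differing-intersection U V ⊤ U₁ nonempty differs-relabelled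
      (U₂ , U₃ , shape , nonempty-U₃ , U₃⊆U₂ , separates) = separate U V Q nonempty-Q differs-Q
  in U₂ , U₃ , shape , nonempty-U₃ , U₃⊆U₂ , λ e → separates (trans e (ell-image U ρ U₂ U₃))
  where
  V = relabel ρ U

  relabel-⊤ : ell U ⊤ (image ρ U₁) ≡ ell V ⊤ U₁
  relabel-⊤ = begin
    ell U ⊤ (image ρ U₁)            ≡⟨ cong (λ P → ell U P (image ρ U₁)) (sym (image-⊤ ρ)) ⟩
    ell U (image ρ ⊤) (image ρ U₁)  ≡⟨ ell-image U ρ ⊤ U₁ ⟩
    ell V ⊤ U₁                      ∎
    where open ≡-Reasoning

  differs-relabelled : ell U ⊤ U₁ ≢ ell V ⊤ U₁
  differs-relabelled e = differs (trans e (sym relabel-⊤))
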